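{- Let $\lambda\ge0$. Every graph with tree-length $\lambda$ satisfies the $(\lambda,2\lambda)$-bow metric.
   Context: Graphs are finite, simple, unweighted, undirected, connected, with shortest-path distance $d$. A tree-decomposition of $G=(V,E)$ is a tree $T$ whose nodes (bags) are subsets of $V$ such that the bags cover $V$, every edge has both endpoints in some bag, and for bags $X,Y,Z$ with $Y$ on the $T$-path from $X$ to $Z$, $X\cap Z\subseteq Y$. Its length is the maximum diameter in $G$ (w.r.t. $d_G$) of a bag; the tree-length of $G$ is the minimum length over all tree-decompositions. The interval is $I(u,v)=\{z: d(u,z)+d(z,v)=d(u,v)\}$. A graph satisfies the $(\lambda,\mu)$-bow metric if for all vertices $u,v,w,x$ with $v\in I(u,w)$, $w\in I(v,x)$ and $d(v,w)>\lambda$, one has $d(u,x)\ge d(u,v)+d(v,w)+d(w,x)-\mu$. -}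

module Defs where

open import Data.Nat using (ℕ; zero; suc; _+_; _*_; _≤_; _<_)
open import Data.Fin using (Fin)
open import Data.Bool using (Bool; true)
open import Data.List using (List; []; _∷_)
open import Data.List.Membership.Propositional using (_∈_)
open import Data.List.Relation.Unary.Unique.Propositional using (Unique)
open import Data.Product using (Σ; ∃; ∃-syntax; _×_; _,_)
open import Relation.Binary.PropositionalEquality using (_≡_)
open import Relation.Nullary using (¬_)

record Graph (n : ℕ) : Set₁ where
  field
    Adj   : Fin n → Fin n → Set
    sym   : ∀ {u v} → Adj u v → Adj v u
    irrefl : ∀ {u} → ¬ Adj u u
open Graph public

data Walk {n : ℕ} (G : Graph n) : Fin n → Fin n → ℕ → Set where
  here : ∀ {u} → Walk G u u 0
  step : ∀ {u v w k} → Adj G u v → Walk G v w k → Walk G u w (suc k)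

Connected : ∀ {n} → Graph n → Set
Connected G = ∀ u v → ∃[ k ] Walk G u v k

IsDist : ∀ {n} → Graph n → Fin n → Fin n → ℕ → Set
IsDist G u v k = Walk G u v k × (∀ j → Walk G u v j → k ≤ j)

IsDistFun : ∀ {n} → Graph n → (Fin n → Fin n → ℕ) → Set
IsDistFun G d = ∀ u v → IsDist G u v (d u v)

data PathList {m : ℕ} (T : Graph m) : Fin m → Fin m → List (Fin m) → Set where
  single : ∀ {x} → PathList T x x (x ∷ [])
  cons   : ∀ {x y z p} → Adj T x y → PathList T y z (y ∷ p) → PathList T x z (x ∷ y ∷ p)

SimplePath : ∀ {m} → Graph m → Fin m → Fin m → List (Fin m) → Set
SimplePath T x y p = PathList T x y p × Unique p

-- A tree: connected and acyclic (any two simple paths between the same endpoints coincide).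
IsTree : ∀ {m} → Graph m → Set
IsTree T = Connected T × (∀ x y p q → SimplePath T x y p → SimplePath T x y q → p ≡ q)

OnPath : ∀ {m} → Graph m → Fin m → Fin m → Fin m → Set
OnPath T X Y Z = ∃[ p ] (SimplePath T X Z p × Y ∈ p)

record TreeDecomposition {n : ℕ} (G : Graph n) : Set₁ where
  field
    m     : ℕ
    T     : Graph m
    tree  : IsTree T
    bag   : Fin m → Fin n → Bool
    cover : ∀ v → ∃[ t ] bag t v ≡ true
    edges : ∀ u v → Adj G u v → ∃[ t ] (bag t u ≡ true × bag t v ≡ true)
    coh   : ∀ X Y Z → OnPath T X Y Z → ∀ v → bag X v ≡ true → bag Z v ≡ true → bag Y v ≡ true
open TreeDecomposition public

LengthAtMost : ∀ {n} {G : Graph n} → (Fin n → Fin n → ℕ) → TreeDecomposition G → ℕ → Set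
LengthAtMost d D k = ∀ t u v → bag D t u ≡ true → bag D t v ≡ true → d u v ≤ k

TreeLength : ∀ {n} (G : Graph n) → (Fin n → Fin n → ℕ) → ℕ → Set₁
TreeLength G d λ′ =
  (∃[ D ] LengthAtMost {G = G} d D λ′) ×
  (∀ k → k < λ′ → (D : TreeDecomposition G) → ¬ LengthAtMost d D k)

InInterval : ∀ {n} → (Fin n → Fin n → ℕ) → Fin n → Fin n → Fin n → Set
InInterval d u z v = d u z + d z v ≡ d u v

BowMetric : ∀ {n} → (Fin n → Fin n → ℕ) → ℕ → ℕ → Set
BowMetric d λ′ μ = ∀ u v w x → InInterval d u v w → InInterval d v w x → λ′ < d v w →
  d u v + d v w + d w x ≤ d u x + μ

{-# OPTIONS --safe #-}
module Submission where

-- Fix a tree-decomposition of length λ and bags U ∋ u, V ∋ v, X ∋ x, and let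
-- M be the median of U, V, X in the tree.  Since the bags on a tree path
-- separate the ends of any walk between them, the bag M meets a geodesic
-- [u,x], a geodesic [u,v], and the walk [v,w]·[w,x].  If M meets [v,w] in a,
-- and [u,x] in s, then going through a and s shows that
-- d(u,v) + d(v,w) + d(w,x) ≤ d(u,x) + 2 d(s,a) ≤ d(u,x) + 2λ.  Otherwise M
-- meets [u,v] and [w,x], and two such points b, c satisfy d(v,w) ≤ d(b,c) ≤ λ.

open import Defs
open import Data.Bool using (true)
open import Data.Nat using (ℕ; suc; _+_; _*_; _≤_)
open import Data.Nat.Properties
  using (≤-antisym; ≤-trans; ≤-reflexive; +-mono-≤; +-monoʳ-≤; *-monoʳ-≤;
         +-cancelˡ-≤; +-cancelʳ-≤; *-cancelˡ-≤; <⇒≱; +-assoc; +-comm; module ≤-Reasoning)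
open import Data.Nat.Tactic.RingSolver using (solve-∀)
open import Data.Fin using (Fin)
open import Data.Fin.Properties using (_≟_)
open import Data.List using (List; []; _∷_; _++_)
open import Data.List.Membership.Propositional using (_∈_)
open import Data.List.Membership.Propositional.Properties using (∈-++⁺ˡ; ∈-++⁻)
open import Data.List.Relation.Binary.Subset.Propositional using (_⊆_)
open import Data.List.Relation.Unary.Any using (here; there)
open import Data.List.Relation.Unary.All as All using ()
open import Data.List.Relation.Unary.All.Properties using (¬Any⇒All¬)
open import Data.List.Relation.Unary.AllPairs as AllPairs using ([]; _∷_)
import Data.List.Relation.Unary.Unique.Propositional.Properties as Unique
open import Data.Product using (∃-syntax; _×_; _,_; proj₁; proj₂)
open import Data.Sum using (_⊎_; inj₁; inj₂; map₁)
open import Data.Empty using (⊥-elim)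
open import Relation.Binary.PropositionalEquality using (_≡_; refl; cong; cong₂; subst)
open import Relation.Nullary using (¬_; yes; no)

module Walks {n : ℕ} (G : Graph n) where

  infix 4 _∈ʷ_
  _∈ʷ_ : ∀ {a b k} → Fin n → Walk G a b k → Set
  _∈ʷ_ {a} z here       = z ≡ a
  _∈ʷ_ {a} z (step _ w) = z ≡ a ⊎ z ∈ʷ w

  infixr 5 _++ʷ_
  _++ʷ_ : ∀ {a b c i j} → Walk G a b i → Walk G b c j → Walk G a c (i + j)
  here     ++ʷ w′ = w′
  step e w ++ʷ w′ = step e (w ++ʷ w′)

  ∈-++ʷ⁻ : ∀ {a b c i j z} (w : Walk G a b i) {w′ : Walk G b c j} →
           z ∈ʷ w ++ʷ w′ → z ∈ʷ w ⊎ z ∈ʷ w′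
  ∈-++ʷ⁻ here       z∈w′       = inj₂ z∈w′
  ∈-++ʷ⁻ (step e w) (inj₁ z≡a) = inj₁ (inj₁ z≡a)
  ∈-++ʷ⁻ (step e w) (inj₂ z∈)  = map₁ inj₂ (∈-++ʷ⁻ w z∈)

  reverseʷ : ∀ {a b k} → Walk G a b k → Walk G b a k
  reverseʷ here               = here
  reverseʷ (step {k = k} e w) =
    subst (Walk G _ _) (+-comm k 1) (reverseʷ w ++ʷ step (Graph.sym G e) here)

  splitʷ : ∀ {a b k z} (w : Walk G a b k) → z ∈ʷ w →
           ∃[ i ] ∃[ j ] Walk G a z i × Walk G z b j × i + j ≡ k
  splitʷ here         refl        = 0 , 0 , here , here , refl
  splitʷ w@(step _ _) (inj₁ refl) = 0 , _ , here , w , refl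
  splitʷ (step e w)   (inj₂ z∈w) with splitʷ w z∈w
  ... | i , j , w₁ , w₂ , i+j≡k = suc i , j , step e w₁ , w₂ , cong suc i+j≡k

module ShortestPaths {n : ℕ} {G : Graph n} {d : Fin n → Fin n → ℕ} (isDist : IsDistFun G d) where
  open Walks G
  open ≤-Reasoning

  geodesic : ∀ a b → Walk G a b (d a b)
  geodesic a b = proj₁ (isDist a b)

  d≤length : ∀ {a b k} → Walk G a b k → d a b ≤ k
  d≤length w = proj₂ (isDist _ _) _ w

  d-triangle : ∀ a b c → d a c ≤ d a b + d b c
  d-triangle a b c = d≤length (geodesic a b ++ʷ geodesic b c)

  d-sym : ∀ a b → d a b ≡ d b a
  d-sym a b = ≤-antisym (d≤length (reverseʷ (geodesic b a))) (d≤length (reverseʷ (geodesic a b)))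

  geodesic⇒∈I : ∀ {a b z} (w : Walk G a b (d a b)) → z ∈ʷ w → InInterval d a z b
  geodesic⇒∈I w z∈w with splitʷ w z∈w
  ... | _ , _ , w₁ , w₂ , i+j≡ =
    ≤-antisym (≤-trans (+-mono-≤ (d≤length w₁) (d≤length w₂)) (≤-reflexive i+j≡)) (d-triangle _ _ _)

  ∈I-restrictʳ : ∀ {u v w a} → InInterval d u v w → InInterval d v a w → InInterval d u v a
  ∈I-restrictʳ {u} {v} {w} {a} v∈uw a∈vw = ≤-antisym uv+va≤ua (d-triangle u v a)
    where
    uv+va≤ua : d u v + d v a ≤ d u a
    uv+va≤ua = +-cancelʳ-≤ (d a w) _ _ (begin
      d u v + d v a + d a w   ≡⟨ +-assoc (d u v) _ _ ⟩
      d u v + (d v a + d a w) ≡⟨ cong (d u v +_) a∈vw ⟩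
      d u v + d v w           ≡⟨ v∈uw ⟩
      d u w                   ≤⟨ d-triangle u a w ⟩
      d u a + d a w           ∎)

  ∈I-restrictˡ : ∀ {v w x a} → InInterval d v w x → InInterval d v a w → InInterval d a w x
  ∈I-restrictˡ {v} {w} {x} {a} w∈vx a∈vw = ≤-antisym aw+wx≤ax (d-triangle a w x)
    where
    aw+wx≤ax : d a w + d w x ≤ d a x
    aw+wx≤ax = +-cancelˡ-≤ (d v a) _ _ (begin
      d v a + (d a w + d w x) ≡⟨ +-assoc (d v a) _ _ ⟨
      d v a + d a w + d w x   ≡⟨ cong (_+ d w x) a∈vw ⟩
      d v w + d w x           ≡⟨ w∈vx ⟩
      d v x                   ≤⟨ d-triangle v a x ⟩
      d v a + d a x           ∎)

  bow-excess≤ : ∀ {u v w x s a} → InInterval d u v w → InInterval d v w x →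
                InInterval d u s x → InInterval d v a w →
                d u v + d v w + d w x ≤ d u x + 2 * d s a
  bow-excess≤ {u} {v} {w} {x} {s} {a} v∈uw w∈vx s∈ux a∈vw = begin
    d u v + d v w + d w x               ≡⟨ cong (λ t → d u v + t + d w x) a∈vw ⟨
    d u v + (d v a + d a w) + d w x     ≡⟨ regroup (d u v) _ _ _ ⟩
    (d u v + d v a) + (d a w + d w x)   ≡⟨ cong₂ _+_ (∈I-restrictʳ v∈uw a∈vw) (∈I-restrictˡ w∈vx a∈vw) ⟩
    d u a + d a x                       ≤⟨ +-mono-≤ (d-triangle u s a) (d-triangle a s x) ⟩
    (d u s + d s a) + (d a s + d s x)   ≡⟨ cong (λ t → (d u s + d s a) + (t + d s x)) (d-sym a s) ⟩
    (d u s + d s a) + (d s a + d s x)   ≡⟨ collect (d u s) _ _ ⟩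
    (d u s + d s x) + 2 * d s a         ≡⟨ cong (_+ 2 * d s a) s∈ux ⟩
    d u x + 2 * d s a                   ∎
    where
    regroup : ∀ p q r t → p + (q + r) + t ≡ (p + q) + (r + t)
    regroup = solve-∀
    collect : ∀ p q r → (p + q) + (q + r) ≡ (p + r) + 2 * q
    collect = solve-∀

  bow-middle≤ : ∀ {u v w x b c} → InInterval d u v w → InInterval d v w x →
                InInterval d u b v → InInterval d w c x → d v w ≤ d b c
  bow-middle≤ {u} {v} {w} {x} {b} {c} v∈uw w∈vx b∈uv c∈wx =
    *-cancelˡ-≤ 2 (+-cancelʳ-≤ (d b v + d w c) _ _ (begin
      2 * d v w + (d b v + d w c)         ≡⟨ spread (d v w) (d b v) (d w c) ⟩
      (d b v + d v w) + (d v w + d w c)   ≡⟨ cong₂ _+_ (∈I-restrictˡ v∈uw b∈uv) (∈I-restrictʳ w∈vx c∈wx) ⟩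
      d b w + d v c                       ≤⟨ +-mono-≤ (d-triangle b c w) (d-triangle v b c) ⟩
      (d b c + d c w) + (d v b + d b c)   ≡⟨ cong₂ (λ p q → (d b c + p) + (q + d b c)) (d-sym c w) (d-sym v b) ⟩
      (d b c + d w c) + (d b v + d b c)   ≡⟨ collect (d b c) _ _ ⟩
      2 * d b c + (d b v + d w c)         ∎))
    where
    spread : ∀ p q r → 2 * p + (q + r) ≡ (q + p) + (p + r)
    spread = solve-∀
    collect : ∀ p q r → (p + q) + (r + p) ≡ 2 * p + (r + q)
    collect = solve-∀

module Paths {m : ℕ} (T : Graph m) where
  open import Data.List.Membership.DecPropositional (_≟_ {m}) using (_∈?_)

  path-head : ∀ {x y p} → PathList T x y p → ∃[ r ] p ≡ x ∷ r
  path-head single     = [] , refl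
  path-head (cons _ _) = _ , refl

  first∈path : ∀ {x y p} → PathList T x y p → x ∈ p
  first∈path single     = here refl
  first∈path (cons _ _) = here refl

  last∈path : ∀ {x y p} → PathList T x y p → y ∈ p
  last∈path single     = here refl
  last∈path (cons _ r) = there (last∈path r)

  ∷-path : ∀ {x y z q} → Adj T x y → PathList T y z q → PathList T x z (x ∷ q)
  ∷-path e single      = cons e single
  ∷-path e (cons e′ r) = cons e (cons e′ r)

  infixr 5 _++ₚ_
  _++ₚ_ : ∀ {x y z p r} → PathList T x y p → PathList T y z (y ∷ r) → PathList T x z (p ++ r)
  single   ++ₚ q = q
  cons e p ++ₚ q = cons e (p ++ₚ q)

  walk⇒path : ∀ {a b k} → Walk T a b k → ∃[ p ] PathList T a b p
  walk⇒path here       = _ , single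
  walk⇒path (step e w) = _ , ∷-path e (proj₂ (walk⇒path w))

  suffix : ∀ {x y z q} → SimplePath T y z q → x ∈ q → ∃[ r ] SimplePath T x z r × r ⊆ q
  suffix sp@(single , _)     (here refl) = _ , sp , λ t∈ → t∈
  suffix sp@(cons _ _ , _)   (here refl) = _ , sp , λ t∈ → t∈
  suffix (single , _)        (there ())
  suffix (cons _ r , _ ∷ uq) (there x∈) with suffix (r , uq) x∈
  ... | r′ , sp′ , r′⊆ = r′ , sp′ , λ t∈ → there (r′⊆ t∈)

  simplify : ∀ {x y p} → PathList T x y p → ∃[ q ] SimplePath T x y q × q ⊆ p
  simplify single = _ , (single , All.[] ∷ []) , λ t∈ → t∈
  simplify (cons {x} e r) with simplify r
  ... | q , (pq , uq) , q⊆ with x ∈? q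
  ... | yes x∈q = let r′ , sp , r′⊆q = suffix (pq , uq) x∈q in r′ , sp , λ t∈ → there (q⊆ (r′⊆q t∈))
  ... | no  x∉q = x ∷ q , (∷-path e pq , ¬Any⇒All¬ q x∉q ∷ uq) ,
                  λ { (here t≡x) → here t≡x ; (there t∈q) → there (q⊆ t∈q) }

  first-meet : ∀ {x y q} (p : List (Fin m)) → SimplePath T x y q → y ∈ p →
               ∃[ z ] ∃[ r ] z ∈ p × SimplePath T x z r × r ⊆ q × (∀ {t} → t ∈ r → t ∈ p → t ≡ z)
  first-meet {x} p sp y∈p with x ∈? p
  ... | yes x∈p = x , _ , x∈p , (single , All.[] ∷ []) , (λ { (here refl) → first∈path (proj₁ sp) }) ,
                  λ { (here refl) _ → refl }
  first-meet p (single , _) y∈p | no x∉p = ⊥-elim (x∉p y∈p)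
  first-meet {x} p (cons e r , x∉ ∷ uq) y∈p | no x∉p with first-meet p (r , uq) y∈p
  ... | z , r′ , z∈p , (pr′ , ur′) , r′⊆ , meets =
    z , x ∷ r′ , z∈p ,
    (∷-path e pr′ , All.tabulate (λ t∈ → All.lookup x∉ (r′⊆ t∈)) ∷ ur′) ,
    (λ { (here t≡x) → here t≡x ; (there t∈) → there (r′⊆ t∈) }) ,
    λ { (here refl) t∈p → ⊥-elim (x∉p t∈p) ; (there t∈) t∈p → meets t∈ t∈p }

module Trees {m : ℕ} {T : Graph m} (isTree : IsTree T) where
  open Paths T

  simplePath : ∀ X Z → ∃[ p ] SimplePath T X Z p
  simplePath X Z with simplify (proj₂ (walk⇒path (proj₂ (proj₁ isTree X Z))))
  ... | p , sp , _ = p , sp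

  onPath⇒∈path : ∀ {X Y Z p} → OnPath T X Y Z → PathList T X Z p → Y ∈ p
  onPath⇒∈path (q , sq , Y∈q) pl with simplify pl
  ... | q′ , sq′ , q′⊆p = q′⊆p (subst (_ ∈_) (proj₂ isTree _ _ q q′ sq sq′) Y∈q)

  onPath-split : ∀ {X Y Z} B → OnPath T X Y Z → OnPath T X Y B ⊎ OnPath T B Y Z
  onPath-split {X} {Z = Z} B onXZ with simplePath X B | simplePath B Z
  ... | p , sp | q , sq with path-head (proj₁ sq)
  ... | r , refl with ∈-++⁻ p (onPath⇒∈path onXZ (proj₁ sp ++ₚ proj₁ sq))
  ... | inj₁ Y∈p = inj₁ (p , sp , Y∈p)
  ... | inj₂ Y∈r = inj₂ (_ , sq , there Y∈r)

  -- M is the first vertex of the path X → Y lying on the path Y → Z, so that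
  -- the X → M part followed by the M → Z part is still a simple path.
  median : ∀ X Y Z → ∃[ M ] OnPath T X M Y × OnPath T Y M Z × OnPath T X M Z
  median X Y Z with simplePath X Y | simplePath Y Z
  ... | q , sq | p , sp with path-head (proj₁ sp)
  ... | _ , refl with first-meet p sq (here refl)
  ... | M , r , M∈p , (pr , ur) , r⊆q , meets with suffix sp M∈p
  ... | s , (ps , us) , s⊆p with path-head ps
  ... | s′ , refl =
    M , (q , sq , r⊆q (last∈path pr)) , (p , sp , M∈p) ,
    (r ++ s′ , (pr ++ₚ ps , Unique.++⁺ ur (AllPairs.tail us) disjoint) , ∈-++⁺ˡ (last∈path pr))
    where
    disjoint : ∀ {t} → ¬ (t ∈ r × t ∈ s′)
    disjoint (t∈r , t∈s′) with meets t∈r (s⊆p (there t∈s′))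
    ... | refl = All.lookup (AllPairs.head us) t∈s′ refl

module Decompositions {n : ℕ} {G : Graph n} (D : TreeDecomposition G) where
  open Walks G
  open Trees (tree D)

  bag-on-path-meets-walk : ∀ {a c k A C Y} (w : Walk G a c k) →
                           bag D A a ≡ true → bag D C c ≡ true → OnPath (T D) A Y C →
                           ∃[ z ] z ∈ʷ w × bag D Y z ≡ true
  bag-on-path-meets-walk {a} here a∈A a∈C onAC = a , refl , coh D _ _ _ onAC a a∈A a∈C
  bag-on-path-meets-walk {a} (step {v = a′} e w) a∈A c∈C onAC with edges D a a′ e
  ... | B , a∈B , a′∈B with onPath-split B onAC
  ... | inj₁ onAB = a , inj₁ refl , coh D _ _ _ onAB a a∈A a∈B
  ... | inj₂ onBC with bag-on-path-meets-walk w a′∈B c∈C onBC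
  ...   | z , z∈w , z∈Y = z , inj₂ z∈w , z∈Y

proposition5 : ∀ (λ′ : ℕ) {n : ℕ} (G : Graph n) (d : Fin n → Fin n → ℕ) → Connected G → IsDistFun G d →
    TreeLength G d λ′ → BowMetric d λ′ (2 * λ′)
proposition5 λ′ G d _ isDist ((D , bags≤λ) , _) u v w x v∈uw w∈vx λ<vw = bow
  where
  open Walks G
  open ShortestPaths isDist
  open Trees (tree D)
  open Decompositions D

  bow : d u v + d v w + d w x ≤ d u x + 2 * λ′
  bow with cover D u | cover D v | cover D x
  ... | U , u∈U | V , v∈V | X , x∈X with median U V X
  ... | M , onUV , onVX , onUX
      with bag-on-path-meets-walk (geodesic u x) u∈U x∈X onUX
         | bag-on-path-meets-walk (geodesic u v) u∈U v∈V onUV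
         | bag-on-path-meets-walk (geodesic v w ++ʷ geodesic w x) v∈V x∈X onVX
  ... | s , s∈ux , s∈M | b , b∈uv , b∈M | z , z∈vwx , z∈M with ∈-++ʷ⁻ (geodesic v w) z∈vwx
  ... | inj₁ z∈vw = ≤-trans (bow-excess≤ v∈uw w∈vx (geodesic⇒∈I _ s∈ux) (geodesic⇒∈I _ z∈vw))
                            (+-monoʳ-≤ (d u x) (*-monoʳ-≤ 2 (bags≤λ M s z s∈M z∈M)))
  ... | inj₂ z∈wx = ⊥-elim (<⇒≱ λ<vw (≤-trans (bow-middle≤ v∈uw w∈vx (geodesic⇒∈I _ b∈uv) (geodesic⇒∈I _ z∈wx))
                                              (bags≤λ M b z b∈M z∈M)))
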